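{- Let $d\ge 2$ be an integer. Suppose $G$ is a graph which is weakly $2$-locally $\mathbb{L}^d$, and suppose $p:V(\mathbb{L}^d)\to V(G)$ is a covering map from $\mathbb{L}^d$ to $G$. Then for every $x\in\mathbb{Z}^d$ and every $i\in\{1,\dots,d\}$, the vertices $p(x+e_i)$ and $p(x-e_i)$ are opposite one another across $p(x)$.
   Context: $\mathbb{L}^d$ is the graph with vertex set $\mathbb{Z}^d$ and edges $\{x,x+e_i\}$. For a graph $G$ and vertex $v$, $\mathrm{Link}^-_r(v,G)$ is the subgraph consisting of all vertices at graph distance at most $r$ from $v$ and all edges having an endpoint at distance less than $r$ from $v$; $G$ is weakly $r$-locally $\mathbb{L}^d$ if for every vertex $v$ there is a graph isomorphism $\mathrm{Link}^-_r(0,\mathbb{L}^d)\to\mathrm{Link}^-_r(v,G)$ sending $0$ to $v$. A covering map is a graph homomorphism $p:V(F)\to V(G)$ mapping the neighbour set of each vertex $v$ bijectively onto the neighbour set of $p(v)$. If $u$ is a vertex of $G$ and $a,b$ are distinct neighbours of $u$, then $a$ and $b$ are said to be opposite one another across $u$ if $u$ is their only common neighbour. -}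

module Defs where

open import Level using (0ℓ)
open import Data.Nat using (ℕ; zero; suc)
open import Data.Fin using (Fin)
open import Data.Integer as ℤ using (ℤ)
open import Data.Vec using (Vec; updateAt; replicate)
open import Data.Product using (Σ; ∃; _×_; _,_)
open import Data.Sum using (_⊎_)
open import Data.Empty using (⊥)
open import Relation.Nullary using (¬_)
open import Relation.Binary.PropositionalEquality using (_≡_; _≢_)

record Graph : Set₁ where
  field
    V       : Set
    Adj     : V → V → Set
    Adj-sym : ∀ {x y} → Adj x y → Adj y x
    Adj-irr : ∀ {x} → ¬ Adj x x
open Graph public

_+e_ : ∀ {d} → Vec ℤ d → Fin d → Vec ℤ d
x +e i = updateAt x i ℤ.suc

_-e_ : ∀ {d} → Vec ℤ d → Fin d → Vec ℤ d
x -e i = updateAt x i ℤ.pred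

origin : ∀ d → Vec ℤ d
origin d = replicate d (ℤ.+ 0)

LAdj : ∀ {d} → Vec ℤ d → Vec ℤ d → Set
LAdj x y = Σ (Fin _) λ i → (y ≡ x +e i) ⊎ (x ≡ y +e i)

L : ℕ → Graph
L d = record
  { V = Vec ℤ d
  ; Adj = LAdj
  ; Adj-sym = λ { (i , Data.Sum.inj₁ p) → i , Data.Sum.inj₂ p
                ; (i , Data.Sum.inj₂ p) → i , Data.Sum.inj₁ p }
  ; Adj-irr = irr
  }
  where
  open import Data.Vec.Properties using (lookup∘updateAt)
  open import Data.Vec using (lookup)
  open import Data.Integer.Properties using (i≢suc[i])
  open import Relation.Binary.PropositionalEquality using (cong; trans; sym)
  sucLook : ∀ {x : Vec ℤ d} i → lookup (x +e i) i ≡ ℤ.suc (lookup x i)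
  sucLook {x} i = lookup∘updateAt i x
  irr : ∀ {x} → ¬ LAdj x x
  irr {x} (i , Data.Sum.inj₁ p) = i≢suc[i] (trans (cong (λ z → lookup z i) p) (sucLook {x} i))
  irr {x} (i , Data.Sum.inj₂ p) = i≢suc[i] (trans (cong (λ z → lookup z i) p) (sucLook {x} i))

module _ (G : Graph) where
  data Within (v : V G) : ℕ → V G → Set where
    here : ∀ {n} → Within v n v
    step : ∀ {n u w} → Within v n u → Adj G u w → Within v (suc n) w

  Within< : V G → ℕ → V G → Set
  Within< v zero    w = ⊥
  Within< v (suc n) w = Within v n w

  -- edges of Link⁻_r(v,G): edges of G with an endpoint at distance < r from v
  LinkEdge : ℕ → V G → V G → V G → Set
  LinkEdge r v a b = Adj G a b × (Within< v r a ⊎ Within< v r b)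

module _ (F G : Graph) where
  record IsCovering (p : V F → V G) : Set where
    field
      hom  : ∀ {x y} → Adj F x y → Adj G (p x) (p y)
      inj  : ∀ {x y z} → Adj F x y → Adj F x z → p y ≡ p z → y ≡ z
      surj : ∀ {x u} → Adj G (p x) u → Σ (V F) λ y → Adj F x y × p y ≡ u

  -- Graph isomorphism Link⁻_r(a,F) → Link⁻_r(b,G) sending a to b, given by
  -- mutually inverse maps between the vertex sets of the two balls
  -- (extended arbitrarily outside the balls) preserving and reflecting link edges.
  record LinkIso (r : ℕ) (a : V F) (b : V G) : Set where
    field
      φ     : V F → V G
      ψ     : V G → V F
      φ-in  : ∀ {w} → Within F a r w → Within G b r (φ w)
      ψ-in  : ∀ {u} → Within G b r u → Within F a r (ψ u)
      ψφ    : ∀ {w} → Within F a r w → ψ (φ w) ≡ w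
      φψ    : ∀ {u} → Within G b r u → φ (ψ u) ≡ u
      edge→ : ∀ {w w'} → Within F a r w → Within F a r w' →
              LinkEdge F r a w w' → LinkEdge G r b (φ w) (φ w')
      edge← : ∀ {w w'} → Within F a r w → Within F a r w' →
              LinkEdge G r b (φ w) (φ w') → LinkEdge F r a w w'
      base  : φ a ≡ b

WeaklyLocallyL : ℕ → ℕ → Graph → Set
WeaklyLocallyL r d G = ∀ (v : V G) → LinkIso (L d) G r (origin d) v

Opposite : (G : Graph) → V G → V G → V G → Set
Opposite G u a b =
  a ≢ b × Adj G u a × Adj G u b ×
  (∀ w → Adj G a w → Adj G b w → w ≡ u)

-- Let c = p x and a = p (x +e i). The radius-2 link isomorphism at c carries a
-- to a neighbour α of the origin of 𝕃^d, and α has an opposite α' there; since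
-- common neighbours of two neighbours of the centre lie in the ball of radius 2,
-- a radius-2 link isomorphism transports oppositeness, so a and a' = φ α' are
-- opposite across c. Lift a' to a neighbour y of x. If y were neither x +e i nor
-- x -e i, the edges x → x +e i and x → y would span a square of 𝕃^d whose fourth
-- corner t ≠ x is a common neighbour of x +e i and y; then p t is a common
-- neighbour of a and a', so p t = p x, contradicting injectivity of p on the
-- neighbourhood of x +e i.
module Submission where

open import Defs
open import Data.Nat using (ℕ; suc; _≤_)
open import Data.Fin using (Fin; _≟_)
open import Data.Integer using (ℤ)
import Data.Integer as ℤ
import Data.Integer.Properties as ℤ
open import Data.Vec using (Vec; lookup)
open import Data.Vec.Properties
  using (lookup∘updateAt; lookup∘updateAt′; updateAt-updateAt; updateAt-id-local; updateAt-commutes)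
open import Data.Product using (∃; _×_; _,_; proj₁; proj₂)
open import Data.Sum using (_⊎_; inj₁; inj₂)
open import Data.Empty using (⊥-elim)
open import Relation.Nullary using (¬_; yes; no)
open import Relation.Binary.PropositionalEquality
open ≡-Reasoning

suc≰pred : ∀ n → ¬ (ℤ.suc n ℤ.≤ ℤ.pred n)
suc≰pred n h = ℤ.<-irrefl refl (ℤ.suc[i]≤j⇒i<j (ℤ.≤-trans h (ℤ.i≤j⇒pred[i]≤j (ℤ.≤-refl {n}))))

Opposite-sym : ∀ G {u a b} → Opposite G u a b → Opposite G u b a
Opposite-sym _ (a≢b , u~a , u~b , common) =
  (λ b≡a → a≢b (sym b≡a)) , u~b , u~a , λ w b~w a~w → common w a~w b~w

Within-suc : ∀ {G v n u} → Within G v n u → Within G v (suc n) u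
Within-suc here       = here
Within-suc (step w e) = step (Within-suc w) e

module _ {d : ℕ} where

  lookup-+e : ∀ (x : Vec ℤ d) i → lookup (x +e i) i ≡ ℤ.suc (lookup x i)
  lookup-+e x i = lookup∘updateAt i x

  lookup--e : ∀ (x : Vec ℤ d) i → lookup (x -e i) i ≡ ℤ.pred (lookup x i)
  lookup--e x i = lookup∘updateAt i x

  lookup-+e-≢ : ∀ (x : Vec ℤ d) {i j} → j ≢ i → lookup (x +e i) j ≡ lookup x j
  lookup-+e-≢ x {i} {j} j≢i = lookup∘updateAt′ j i j≢i x

  -e-+e : ∀ (x : Vec ℤ d) i → (x -e i) +e i ≡ x
  -e-+e x i = trans (updateAt-updateAt i x) (updateAt-id-local i x (ℤ.suc-pred _))

  +e--e : ∀ (x : Vec ℤ d) i → (x +e i) -e i ≡ x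
  +e--e x i = trans (updateAt-updateAt i x) (updateAt-id-local i x (ℤ.pred-suc _))

  +e-injective : ∀ {x y : Vec ℤ d} i → x +e i ≡ y +e i → x ≡ y
  +e-injective {x} {y} i eq = begin
    x             ≡⟨ +e--e x i ⟨
    (x +e i) -e i ≡⟨ cong (_-e i) eq ⟩
    (y +e i) -e i ≡⟨ +e--e y i ⟩
    y             ∎

  +e-comm : ∀ (x : Vec ℤ d) {i j} → i ≢ j → (x +e i) +e j ≡ (x +e j) +e i
  +e-comm x {i} {j} i≢j = updateAt-commutes j i (λ j≡i → i≢j (sym j≡i)) x

  +e≢-e : ∀ (x : Vec ℤ d) i → x +e i ≢ x -e i
  +e≢-e x i eq = suc≰pred (lookup x i) (ℤ.≤-reflexive (begin
    ℤ.suc (lookup x i)  ≡⟨ lookup-+e x i ⟨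
    lookup (x +e i) i   ≡⟨ cong (λ v → lookup v i) eq ⟩
    lookup (x -e i) i   ≡⟨ lookup--e x i ⟩
    ℤ.pred (lookup x i) ∎))

  LAdj-+e-or-lookup-≤ : ∀ {x w : Vec ℤ d} i → LAdj x w → w ≡ x +e i ⊎ lookup w i ℤ.≤ lookup x i
  LAdj-+e-or-lookup-≤ {x} i (j , inj₁ refl) with j ≟ i
  ... | yes refl = inj₁ refl
  ... | no j≢i   = inj₂ (ℤ.≤-reflexive (lookup-+e-≢ x (λ i≡j → j≢i (sym i≡j))))
  LAdj-+e-or-lookup-≤ {w = w} i (j , inj₂ refl) with j ≟ i
  ... | yes refl = inj₂ (ℤ.≤-trans (ℤ.i≤suc[i] _) (ℤ.≤-reflexive (sym (lookup-+e w i))))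
  ... | no j≢i   = inj₂ (ℤ.≤-reflexive (sym (lookup-+e-≢ w (λ i≡j → j≢i (sym i≡j)))))

  L-opposite : ∀ x i → Opposite (L d) x (x +e i) (x -e i)
  L-opposite x i = +e≢-e x i , (i , inj₁ refl) , (i , inj₂ (sym (-e-+e x i))) , common
    where
    -- The i-th coordinate of a common neighbour is squeezed between those of x ± e i.
    common : ∀ w → LAdj (x +e i) w → LAdj (x -e i) w → w ≡ x
    common w x+~w x-~w with LAdj-+e-or-lookup-≤ i x-~w | LAdj-+e-or-lookup-≤ i (Adj-sym (L d) x+~w)
    ... | inj₁ w≡ | _         = trans w≡ (-e-+e x i)
    ... | inj₂ _  | inj₁ x+≡  = sym (+e-injective i x+≡)
    ... | inj₂ w≤ | inj₂ x+≤  = ⊥-elim (suc≰pred (lookup x i) (ℤ.≤-trans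
      (ℤ.≤-trans (ℤ.≤-reflexive (sym (lookup-+e x i))) x+≤)
      (ℤ.≤-trans w≤ (ℤ.≤-reflexive (lookup--e x i)))))

  L-neighbour-has-opposite : ∀ {x y : Vec ℤ d} → LAdj x y → ∃ λ y' → Opposite (L d) x y y'
  L-neighbour-has-opposite {x} (k , inj₁ refl) = x -e k , L-opposite x k
  L-neighbour-has-opposite {y = y} (k , inj₂ refl) =
    (y +e k) +e k , subst (λ z → Opposite (L d) (y +e k) z ((y +e k) +e k)) (+e--e y k)
                          (Opposite-sym (L d) (L-opposite (y +e k) k))

  LAdj-axis-or-square : ∀ {x y : Vec ℤ d} i → LAdj x y →
    y ≡ x +e i ⊎ y ≡ x -e i ⊎ ∃ λ t → LAdj (x +e i) t × LAdj y t × t ≢ x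
  LAdj-axis-or-square {x} i (j , inj₁ refl) with j ≟ i
  ... | yes refl = inj₁ refl
  ... | no j≢i   = inj₂ (inj₂ ((x +e i) +e j , (j , inj₁ refl) , (i , inj₁ (+e-comm x i≢j)) , t≢x))
    where
    i≢j : i ≢ j
    i≢j i≡j = j≢i (sym i≡j)
    t≢x : (x +e i) +e j ≢ x
    t≢x eq = ℤ.i≢suc[i] (begin
      lookup x i                ≡⟨ cong (λ v → lookup v i) eq ⟨
      lookup ((x +e i) +e j) i  ≡⟨ lookup-+e-≢ (x +e i) i≢j ⟩
      lookup (x +e i) i         ≡⟨ lookup-+e x i ⟩
      ℤ.suc (lookup x i)        ∎)
  LAdj-axis-or-square {y = y} i (j , inj₂ refl) with j ≟ i
  ... | yes refl = inj₂ (inj₁ (sym (+e--e y i)))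
  ... | no j≢i   = inj₂ (inj₂ (y +e i , (j , inj₂ (+e-comm y j≢i)) , (i , inj₁ refl) , t≢x))
    where
    t≢x : y +e i ≢ y +e j
    t≢x eq = ℤ.i≢suc[i] (begin
      lookup y j         ≡⟨ lookup-+e-≢ y j≢i ⟨
      lookup (y +e i) j  ≡⟨ cong (λ v → lookup v j) eq ⟩
      lookup (y +e j) j  ≡⟨ lookup-+e y j ⟩
      ℤ.suc (lookup y j) ∎)

module _ {F G : Graph} {r : ℕ} {a : V F} {b : V G} where

  φ-Adj : (ι : LinkIso F G (suc r) a b) → let open LinkIso ι in
    ∀ {w w'} → Within F a r w → Within F a (suc r) w' → Adj F w w' → Adj G (φ w) (φ w')
  φ-Adj ι w∈ w'∈ w~w' = proj₁ (edge→ (Within-suc w∈) w'∈ (w~w' , inj₁ w∈))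
    where open LinkIso ι

  ψ-Adj : (ι : LinkIso F G (suc r) a b) → let open LinkIso ι in
    ∀ {u u'} → Within G b r u → Within G b (suc r) u' → Adj G u u' → Adj F (ψ u) (ψ u')
  ψ-Adj ι u∈ u'∈ u~u' = proj₁ (edge← (ψ-in (Within-suc u∈)) (ψ-in u'∈)
    (subst₂ (LinkEdge G (suc r) b) (sym (φψ (Within-suc u∈))) (sym (φψ u'∈)) (u~u' , inj₁ u∈)))
    where open LinkIso ι

  ψ-base : (ι : LinkIso F G r a b) → LinkIso.ψ ι b ≡ a
  ψ-base ι = trans (cong ψ (sym base)) (ψφ here)
    where open LinkIso ι

LinkIso-Opposite : ∀ {F G a b} (ι : LinkIso F G 2 a b) → let open LinkIso ι in
  ∀ {u u'} → Opposite F a u u' → Opposite G b (φ u) (φ u')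
LinkIso-Opposite {F} {G} {a} {b} ι {u} {u'} (u≢u' , a~u , a~u' , common) =
  φu≢φu' , φ-Adj-base a~u , φ-Adj-base a~u' , common-φ
  where
  open LinkIso ι
  φ-Adj-base : ∀ {v} → Adj F a v → Adj G b (φ v)
  φ-Adj-base a~v = subst (λ c → Adj G c (φ _)) base (φ-Adj ι here (step here a~v) a~v)
  φu≢φu' : φ u ≢ φ u'
  φu≢φu' eq = u≢u' (begin
    u         ≡⟨ ψφ (step here a~u) ⟨
    ψ (φ u)   ≡⟨ cong ψ eq ⟩
    ψ (φ u')  ≡⟨ ψφ (step here a~u') ⟩
    u'        ∎)
  ψ-Adj-φ : ∀ {v w} → Adj F a v → Adj G (φ v) w → Adj F v (ψ w)
  ψ-Adj-φ {v} a~v φv~w =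
    subst (λ z → Adj F z _) (ψφ (step here a~v))
          (ψ-Adj ι (step here (φ-Adj-base a~v)) (step (step here (φ-Adj-base a~v)) φv~w) φv~w)
  common-φ : ∀ w → Adj G (φ u) w → Adj G (φ u') w → w ≡ b
  common-φ w φu~w φu'~w = begin
    w        ≡⟨ φψ (step (step here (φ-Adj-base a~u)) φu~w) ⟨
    φ (ψ w)  ≡⟨ cong φ (common (ψ w) (ψ-Adj-φ a~u φu~w) (ψ-Adj-φ a~u' φu'~w)) ⟩
    φ a      ≡⟨ base ⟩
    b        ∎

covering-opposite-≡-e : ∀ {d G p} → IsCovering (L d) G p → ∀ x i {v} →
  Opposite G (p x) (p (x +e i)) v → v ≡ p (x -e i)
covering-opposite-≡-e {d} {G} {p} cov x i {v} (a≢v , _ , px~v , common) =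
  trans (sym py≡v) (cong p (lift-≡-e (LAdj-axis-or-square i x~y)))
  where
  open IsCovering cov
  y : Vec ℤ d
  y = proj₁ (surj px~v)
  x~y : LAdj x y
  x~y = proj₁ (proj₂ (surj px~v))
  py≡v : p y ≡ v
  py≡v = proj₂ (proj₂ (surj px~v))
  lift-≡-e : y ≡ x +e i ⊎ y ≡ x -e i ⊎ ∃ (λ t → LAdj (x +e i) t × LAdj y t × t ≢ x) → y ≡ x -e i
  lift-≡-e (inj₁ y≡x+e)        = ⊥-elim (a≢v (trans (cong p (sym y≡x+e)) py≡v))
  lift-≡-e (inj₂ (inj₁ y≡x-e)) = y≡x-e
  lift-≡-e (inj₂ (inj₂ (t , x+~t , y~t , t≢x))) = ⊥-elim (t≢x (inj x+~t (i , inj₂ refl)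
    (common (p t) (hom x+~t) (subst (λ z → Adj G z (p t)) py≡v (hom y~t)))))

lemma3 : (d : ℕ) → 2 ≤ d → (G : Graph) → WeaklyLocallyL 2 d G →
         (p : Vec ℤ d → V G) → IsCovering (L d) G p →
         (x : Vec ℤ d) (i : Fin d) →
         Opposite G (p x) (p (x +e i)) (p (x -e i))
lemma3 d _ G wl p cov x i =
  subst (Opposite G (p x) (p (x +e i))) (covering-opposite-≡-e cov x i a⋈φα') a⋈φα'
  where
  ι : LinkIso (L d) G 2 (origin d) (p x)
  ι = wl (p x)
  open LinkIso ι
  open IsCovering cov using (hom)
  px~a : Adj G (p x) (p (x +e i))
  px~a = hom (i , inj₁ refl)
  o~ψa : LAdj (origin d) (ψ (p (x +e i)))
  o~ψa = subst (λ z → LAdj z (ψ (p (x +e i)))) (ψ-base ι)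
               (ψ-Adj ι here (Within-suc (step here px~a)) px~a)
  α' : Vec ℤ d
  α' = proj₁ (L-neighbour-has-opposite o~ψa)
  a⋈φα' : Opposite G (p x) (p (x +e i)) (φ α')
  a⋈φα' = subst (λ a → Opposite G (p x) a (φ α')) (φψ (step here px~a))
                (LinkIso-Opposite ι (proj₂ (L-neighbour-has-opposite o~ψa)))
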